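{- Let $t\ge1$ be an integer. For a finite graph $G$ (loops and multiple edges allowed), let $\hat G$ be the graph on the same vertex set obtained by replacing each edge $e$ of $G$ by $t$ parallel copies $e_1,\dots,e_t$ (a loop being replaced by $t$ loops), and set $J_G(x,y):=T_{\hat G}(x,y)$. Then: (1) if $G$ has no edges, $J_G(x,y)=1$; (2) if $e$ is a loop of $G$, $J_G(x,y)=y^t J_{G-e}(x,y)$; (3) if $e$ is a bridge of $G$, $J_G(x,y)=(y^{t-1}+\dots+y+1)\,J_{G\cdot e}(x,y)+(x-1)\,J_{G-e}(x,y)$; (4) if $e$ is neither a loop nor a bridge, $J_G(x,y)=(y^{t-1}+\dots+y+1)\,J_{G\cdot e}(x,y)+J_{G-e}(x,y)$.
   Context: $T_H(x,y)$ denotes the Tutte polynomial of a graph $H$. $G-e$ is the graph obtained by deleting the edge $e$, and $G\cdot e$ the graph obtained by contracting $e$. -}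

module Defs where

open import Level using (Level)
open import Data.Nat using (ℕ; zero; suc; _∸_; _<_)
open import Data.Fin using (Fin; punchOut)
open import Data.Fin.Properties using (_≟_)
open import Data.Bool using (if_then_else_)
open import Data.Product using (_×_; _,_; proj₁; proj₂)
open import Data.List using (List; []; _∷_; length; map; lookup; removeAt; concatMap; replicate; foldl; allFin; filter; _++_)
open import Relation.Nullary using (yes; no; ¬_; does)
open import Relation.Binary.PropositionalEquality using (_≡_; sym)
open import Algebra.Bundles using (CommutativeRing)

record Graph : Set where
  constructor graph
  field
    n     : ℕ
    edges : List (Fin n × Fin n)
open Graph public

-- An edge of G is a position in its edge list.
Edge : Graph → Set
Edge G = Fin (length (edges G))

delete : (G : Graph) → Edge G → Graph
delete (graph n es) i = graph n (removeAt es i)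

-- Identify v with u (u ≢ v) : vertex v is removed, its edges are moved to u.
contractAt : ∀ {n} → Fin n → Fin n → List (Fin n × Fin n) → Graph
contractAt {suc m} u v es with u ≟ v
... | yes _ = graph (suc m) es   -- contracting a loop = deleting it (not used in the theorem)
... | no u≢v = graph m (map (λ p → f (proj₁ p) , f (proj₂ p)) es)
  where
  f : Fin (suc m) → Fin m
  f w with w ≟ v
  ... | yes _ = punchOut {i = v} {j = u} (λ eq → u≢v (sym eq))
  ... | no w≢v = punchOut {i = v} {j = w} (λ eq → w≢v (sym eq))

contract : (G : Graph) → Edge G → Graph
contract (graph n es) i = contractAt (proj₁ (lookup es i)) (proj₂ (lookup es i)) (removeAt es i)

-- Connected components of the spanning subgraph (Fin n, A), via union–find labelling:
-- each vertex carries the label of a representative of its component.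
merge : ∀ {n} → (Fin n → Fin n) → Fin n × Fin n → (Fin n → Fin n)
merge f (u , v) w = if does (f w ≟ f v) then f u else f w

label : ∀ {n} → List (Fin n × Fin n) → Fin n → Fin n
label es = foldl merge (λ w → w) es

components : (n : ℕ) → List (Fin n × Fin n) → ℕ
components n es = length (filter (λ w → label es w ≟ w) (allFin n))

rank : (n : ℕ) → List (Fin n × Fin n) → ℕ
rank n es = n ∸ components n es

-- all sub(multi)sets of an edge list (by position)
subsets : ∀ {A : Set} → List A → List (List A)
subsets [] = [] ∷ []
subsets (x ∷ xs) = subsets xs ++ map (x ∷_) (subsets xs)

IsLoop : (G : Graph) → Edge G → Set
IsLoop (graph n es) i = proj₁ (lookup es i) ≡ proj₂ (lookup es i)

IsBridge : (G : Graph) → Edge G → Set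
IsBridge G i = components (n G) (edges G) < components (n (delete G i)) (edges (delete G i))

hat : ℕ → Graph → Graph
hat t (graph n es) = graph n (concatMap (replicate t) es)

module _ {c ℓ : Level} (R : CommutativeRing c ℓ) where
  open CommutativeRing R

  pow : Carrier → ℕ → Carrier
  pow a zero = 1#
  pow a (suc k) = a * pow a k

  geom : Carrier → ℕ → Carrier
  geom y zero = 0#
  geom y (suc k) = geom y k + pow y k

  sumR : List Carrier → Carrier
  sumR [] = 0#
  sumR (a ∷ as) = a + sumR as

  tutte : Graph → Carrier → Carrier → Carrier
  tutte (graph n es) x y =
    sumR (map (λ A → pow (x + - 1#) (rank n es ∸ rank n A) * pow (y + - 1#) (length A ∸ rank n A))
              (subsets es))

  J : ℕ → Graph → Carrier → Carrier → Carrier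
  J t G x y = tutte (hat t G) x y

-- Write A ⊆ E(Ĝ) as the part S lying in the bundle of the t copies of e plus the rest A₀. If e is a
-- loop, S changes neither connectivity nor rank, so it only contributes (y - 1)^|S|, and summing over S
-- gives yᵗ. Otherwise the terms with S = ∅ give the rank sum of Ĝ - e, except that the corank is still
-- taken relative to Ĝ: this is (x - 1) J_{G-e} if e is a bridge and J_{G-e} if not. A nonempty S acts as
-- one copy of e, which is contracted and lowers every rank by one, plus |S| - 1 loops in Ĝ·e; so these
-- terms give J_{G·e} times ∑_{S ≠ ∅} (y - 1)^(|S|-1) = y^(t-1) + ⋯ + 1. Most of the work is the bookkeeping
-- of connected components: their number, computed by union–find labelling, depends only on connectivity.

module Submission where

open import Defs
open import Level using (Level; 0ℓ)
open import Function.Base using (_∘_; id)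
open import Function.Bundles using (_⇔_; mk⇔; Equivalence)
open import Data.Bool using (if_then_else_)
open import Data.Empty using (⊥-elim)
open import Data.Nat using (ℕ; zero; suc; _∸_; _≤_; _<_; z≤n; s≤s)
import Data.Nat as ℕ
import Data.Nat.Properties as ℕ
open import Data.Fin using (Fin; punchIn; punchOut)
open import Data.Fin.Properties using (_≟_; punchOut-cong; punchIn-punchOut; punchOut-punchIn; punchInᵢ≢i)
open import Data.Product using (_×_; _,_; proj₁; proj₂)
open import Data.Sum using (_⊎_; inj₁; inj₂)
open import Data.List using (List; []; _∷_; _++_; _∷ʳ_; [_]; length; map; filter; foldl; allFin; replicate; concatMap; lookup; removeAt)
import Data.List.Properties as List
open import Data.List.Membership.Propositional using (_∈_)
open import Data.List.Membership.Propositional.Properties using (∈-++⁺ˡ; ∈-++⁺ʳ; ∈-++⁻; ∈-map⁺; ∈-map⁻; ∈-filter⁺; ∈-filter⁻; ∈-allFin; ∈-∃++)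
open import Data.List.Relation.Binary.Subset.Propositional using (_⊆_)
open import Data.List.Relation.Binary.Subset.Propositional.Properties using (xs⊆xs++ys; xs⊆ys++xs; ⊆-reflexive-↭)
open import Data.List.Relation.Binary.Permutation.Propositional using (_↭_; ↭-sym; ↭-trans)
open import Data.List.Relation.Binary.Permutation.Propositional.Properties using (∷↭∷ʳ; shift; shifts; ↭-length)
open import Data.List.Relation.Unary.Any using (here; there)
import Data.List.Relation.Unary.All as All
import Data.List.Relation.Unary.All.Properties as All
open import Data.List.Relation.Unary.AllPairs using ([]; _∷_)
open import Data.List.Relation.Unary.Unique.Propositional using (Unique)
import Data.List.Relation.Unary.Unique.Propositional.Properties as Unique
open import Relation.Nullary using (yes; no; ¬_; does; Dec)
open import Relation.Nullary.Decidable using (map′)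
open import Relation.Unary using (Pred; Decidable)
open import Relation.Binary.PropositionalEquality using (_≡_; _≢_; refl; sym; trans; cong; cong₂; subst; subst₂; isEquivalence; module ≡-Reasoning)
open import Relation.Binary.Construct.Closure.ReflexiveTransitive using (ε; _◅◅_)
open import Relation.Binary.Construct.Closure.Equivalence as EqClosure using (EqClosure; gfold; _⋆)
open import Algebra.Bundles using (CommutativeRing)

private
  variable
    A B : Set

subsets-⊆ : ∀ (xs : List A) {S} → S ∈ subsets xs → S ⊆ xs
subsets-⊆ [] (here refl) ()
subsets-⊆ (x ∷ xs) S∈ z∈S with ∈-++⁻ (subsets xs) S∈
... | inj₁ S∈′ = there (subsets-⊆ xs S∈′ z∈S)
... | inj₂ S∈′ with ∈-map⁻ (x ∷_) S∈′
... | _ , S′∈ , refl with z∈S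
...   | here z≡x = here z≡x
...   | there z∈S′ = there (subsets-⊆ xs S′∈ z∈S′)

subsets-map : ∀ (f : A → B) xs → subsets (map f xs) ≡ map (map f) (subsets xs)
subsets-map f [] = refl
subsets-map f (x ∷ xs) = begin
  subsets (map f xs) ++ map (f x ∷_) (subsets (map f xs))
    ≡⟨ cong (λ T → T ++ map (f x ∷_) T) (subsets-map f xs) ⟩
  map (map f) S ++ map (f x ∷_) (map (map f) S)  ≡⟨ cong (map (map f) S ++_) (sym (List.map-∘ S)) ⟩
  map (map f) S ++ map (map f ∘ (x ∷_)) S        ≡⟨ cong (map (map f) S ++_) (List.map-∘ S) ⟩
  map (map f) S ++ map (map f) (map (x ∷_) S)    ≡⟨ List.map-++ (map f) S (map (x ∷_) S) ⟨
  map (map f) (S ++ map (x ∷_) S)                ∎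
  where
  open ≡-Reasoning
  S = subsets xs

∈-replicate⁻ : ∀ {x z : A} t → z ∈ replicate t x → z ≡ x
∈-replicate⁻ {x = x} t = All.lookup (All.replicate⁺ {P = _≡ x} t refl)

length-shifts : ∀ (xs ms ys : List A) → length (xs ++ ms ++ ys) ≡ length (xs ++ ys) ℕ.+ length ms
length-shifts xs ms ys =
  trans (↭-length (shifts xs ms)) (trans (List.length-++ ms) (ℕ.+-comm (length ms) _))

record Split (xs : List A) (i : Fin (length xs)) : Set where
  field
    before after : List A
    xs≡ : xs ≡ before ++ lookup xs i ∷ after
    removeAt≡ : removeAt xs i ≡ before ++ after

removeAt-split : ∀ (xs : List A) i → Split xs i
removeAt-split (x ∷ xs) Fin.zero = record { before = [] ; after = xs ; xs≡ = refl ; removeAt≡ = refl }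
removeAt-split (x ∷ xs) (Fin.suc i) = record
  { before = x ∷ before ; after = after ; xs≡ = cong (x ∷_) xs≡ ; removeAt≡ = cong (x ∷_) removeAt≡ }
  where open Split (removeAt-split xs i)

Unique-map-on : ∀ (h : A → B) {xs} → (∀ {a b} → a ∈ xs → b ∈ xs → h a ≡ h b → a ≡ b) →
  Unique xs → Unique (map h xs)
Unique-map-on h {[]} _ [] = []
Unique-map-on h {x ∷ xs} inj (x∉xs ∷ xs!) =
  All.map⁺ (All.tabulate (λ y∈xs → All.lookup x∉xs y∈xs ∘ inj (here refl) (there y∈xs)))
    ∷ Unique-map-on h (λ a∈ b∈ → inj (there a∈) (there b∈)) xs!

Unique-⊆⇒length≤ : ∀ {xs ys : List A} → Unique xs → xs ⊆ ys → length xs ≤ length ys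
Unique-⊆⇒length≤ {xs = []} _ _ = z≤n
Unique-⊆⇒length≤ {xs = x ∷ xs} (x∉xs ∷ xs!) x∷xs⊆ys
  with ys₁ , ys₂ , refl ← ∈-∃++ (x∷xs⊆ys (here refl)) =
  subst (suc (length xs) ≤_) (sym (List.length-++-sucʳ ys₁ x ys₂))
    (s≤s (Unique-⊆⇒length≤ xs! skip-x))
  where
  skip-x : xs ⊆ ys₁ ++ ys₂
  skip-x z∈xs with ∈-++⁻ ys₁ (x∷xs⊆ys (there z∈xs))
  ... | inj₁ z∈ys₁ = ∈-++⁺ˡ z∈ys₁
  ... | inj₂ (here refl) = ⊥-elim (All.lookup x∉xs z∈xs refl)
  ... | inj₂ (there z∈ys₂) = ∈-++⁺ʳ ys₁ z∈ys₂

module _ {P Q : Pred A 0ℓ} (P? : Decidable P) (Q? : Decidable Q) where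

  length-filter-cong : ∀ xs → (∀ {w} → w ∈ xs → P w ⇔ Q w) →
    length (filter P? xs) ≡ length (filter Q? xs)
  length-filter-cong [] _ = refl
  length-filter-cong (x ∷ xs) P⇔Q with P? x | Q? x
  ... | yes _ | yes _ = cong suc (length-filter-cong xs (P⇔Q ∘ there))
  ... | no _  | no _  = length-filter-cong xs (P⇔Q ∘ there)
  ... | yes p | no ¬q = ⊥-elim (¬q (Equivalence.to (P⇔Q (here refl)) p))
  ... | no ¬p | yes q = ⊥-elim (¬p (Equivalence.from (P⇔Q (here refl)) q))

  length-filter-remove : ∀ {xs z} → Unique xs → z ∈ xs → P z → (∀ w → Q w ⇔ (P w × w ≢ z)) →
    length (filter P? xs) ≡ suc (length (filter Q? xs))
  length-filter-remove {x ∷ xs} (x∉xs ∷ xs!) (here refl) pz Q⇔P∖z with P? x | Q? x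
  ... | no ¬p | _ = ⊥-elim (¬p pz)
  ... | yes _ | yes q = ⊥-elim (proj₂ (Equivalence.to (Q⇔P∖z x) q) refl)
  ... | yes _ | no _ = cong suc (length-filter-cong xs P⇔Q)
    where
    P⇔Q : ∀ {w} → w ∈ xs → P w ⇔ Q w
    P⇔Q {w} w∈xs = mk⇔ (λ p → Equivalence.from (Q⇔P∖z w) (p , All.lookup x∉xs w∈xs ∘ sym))
                        (proj₁ ∘ Equivalence.to (Q⇔P∖z w))
  length-filter-remove {x ∷ xs} (x∉xs ∷ xs!) (there z∈xs) pz Q⇔P∖z with P? x | Q? x
  ... | yes _ | yes _ = cong suc (length-filter-remove xs! z∈xs pz Q⇔P∖z)
  ... | no _  | no _  = length-filter-remove xs! z∈xs pz Q⇔P∖z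
  ... | yes p | no ¬q = ⊥-elim (¬q (Equivalence.from (Q⇔P∖z x) (p , All.lookup x∉xs z∈xs)))
  ... | no ¬p | yes q = ⊥-elim (¬p (proj₁ (Equivalence.to (Q⇔P∖z x) q)))

-- Connectivity and the union–find labelling

Edges : ℕ → Set
Edges n = List (Fin n × Fin n)

Connected : ∀ {n} → Edges n → Fin n → Fin n → Set
Connected es = EqClosure (λ a b → (a , b) ∈ es)

module _ {n : ℕ} where

  private
    variable
      es es′ : Edges n
      a b u v : Fin n

  edge : (a , b) ∈ es → Connected es a b
  edge = EqClosure.return

  connected-sym : Connected es a b → Connected es b a
  connected-sym = EqClosure.symmetric _

  Connected-⊆ : es ⊆ es′ → Connected es a b → Connected es′ a b
  Connected-⊆ es⊆es′ = (edge ∘ es⊆es′) ⋆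

  merge-respects : ∀ (f : Fin n → Fin n) e → f a ≡ f b → merge f e a ≡ merge f e b
  merge-respects f (u , v) = cong (λ z → if does (z ≟ f v) then f u else z)

  merge-joins : ∀ (f : Fin n → Fin n) u v → merge f (u , v) u ≡ merge f (u , v) v
  merge-joins f u v with f u ≟ f v | f v ≟ f v
  ... | yes _ | yes _ = refl
  ... | no _  | yes _ = refl
  ... | _     | no fv≢fv = ⊥-elim (fv≢fv refl)

  foldl-merge-respects : ∀ (f : Fin n → Fin n) es → f a ≡ f b → foldl merge f es a ≡ foldl merge f es b
  foldl-merge-respects f [] = id
  foldl-merge-respects f (e ∷ es) = foldl-merge-respects (merge f e) es ∘ merge-respects f e

  foldl-merge-joins : ∀ (f : Fin n → Fin n) es → (a , b) ∈ es → foldl merge f es a ≡ foldl merge f es b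
  foldl-merge-joins f ((u , v) ∷ es) (here refl) = foldl-merge-respects (merge f (u , v)) es (merge-joins f u v)
  foldl-merge-joins f (e ∷ es) (there ab∈es) = foldl-merge-joins (merge f e) es ab∈es

  label-complete : Connected es a b → label es a ≡ label es b
  label-complete {es} = gfold isEquivalence (label es) (foldl-merge-joins (λ w → w) es)

  Connected-∷ʳ : ∀ {pre : Edges n} e → Connected pre a b → Connected (pre ∷ʳ e) a b
  Connected-∷ʳ {pre = pre} e = Connected-⊆ (xs⊆xs++ys pre [ e ])

  Connected-∷ʳ-ends : ∀ (pre : Edges n) → Connected (pre ∷ʳ (u , v)) u v
  Connected-∷ʳ-ends pre = edge (∈-++⁺ʳ pre (here refl))

  merge-sound : ∀ (pre : Edges n) (f : Fin n → Fin n) u v →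
    (∀ {a b} → f a ≡ f b → Connected pre a b) →
    merge f (u , v) a ≡ merge f (u , v) b → Connected (pre ∷ʳ (u , v)) a b
  merge-sound {a} {b} pre f u v sound eq with f a ≟ f v | f b ≟ f v
  ... | yes fa≡fv | yes fb≡fv = Connected-∷ʳ _ (sound (trans fa≡fv (sym fb≡fv)))
  ... | yes fa≡fv | no _ =
    Connected-∷ʳ _ (sound fa≡fv) ◅◅ connected-sym (Connected-∷ʳ-ends pre) ◅◅ Connected-∷ʳ _ (sound eq)
  ... | no _ | yes fb≡fv =
    Connected-∷ʳ _ (sound eq) ◅◅ Connected-∷ʳ-ends pre ◅◅ Connected-∷ʳ _ (sound (sym fb≡fv))
  ... | no _ | no _ = Connected-∷ʳ _ (sound eq)

  foldl-merge-sound : ∀ (pre es : Edges n) (f : Fin n → Fin n) →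
    (∀ {a b} → f a ≡ f b → Connected pre a b) →
    foldl merge f es a ≡ foldl merge f es b → Connected (pre ++ es) a b
  foldl-merge-sound {a} {b} pre [] f sound =
    subst (λ L → Connected L a b) (sym (List.++-identityʳ pre)) ∘ sound
  foldl-merge-sound {a} {b} pre ((u , v) ∷ es) f sound =
    subst (λ L → Connected L a b) (List.++-assoc pre [ (u , v) ] es)
      ∘ foldl-merge-sound (pre ∷ʳ (u , v)) es (merge f (u , v)) (merge-sound pre f u v sound)

  label-sound : label es a ≡ label es b → Connected es a b
  label-sound {es} = foldl-merge-sound [] es (λ w → w) (λ { refl → ε })

  connected? : ∀ es (a b : Fin n) → Dec (Connected es a b)
  connected? es a b = map′ label-sound label-complete (label es a ≟ label es b)

  foldl-merge-idempotent : ∀ (f : Fin n → Fin n) es → (∀ w → f (f w) ≡ f w) →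
    ∀ w → foldl merge f es (foldl merge f es w) ≡ foldl merge f es w
  foldl-merge-idempotent f [] f-idem = f-idem
  foldl-merge-idempotent f ((u , v) ∷ es) f-idem =
    foldl-merge-idempotent (merge f (u , v)) es merge-idem
    where
    merge-idem : ∀ w → merge f (u , v) (merge f (u , v) w) ≡ merge f (u , v) w
    merge-idem w with f w ≟ f v
    ... | yes _ with f (f u) ≟ f v
    ...   | yes _ = refl
    ...   | no _ = f-idem u
    merge-idem w | no fw≢fv with f (f w) ≟ f v
    ...   | yes ffw≡fv = ⊥-elim (fw≢fv (trans (sym (f-idem w)) ffw≡fv))
    ...   | no _ = f-idem w

  label-idempotent : ∀ (es : Edges n) w → label es (label es w) ≡ label es w
  label-idempotent es = foldl-merge-idempotent (λ w → w) es (λ _ → refl)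

-- Counting components

fixedPoints : ∀ {n} → (Fin n → Fin n) → List (Fin n)
fixedPoints {n} f = filter (λ w → f w ≟ w) (allFin n)

fixedPoints-length≤ : ∀ {n m} (f : Fin n → Fin n) (g : Fin m → Fin m) (ψ : Fin n → Fin m) →
  (∀ w → g (g w) ≡ g w) → (∀ a b → g (ψ a) ≡ g (ψ b) → f a ≡ f b) →
  length (fixedPoints f) ≤ length (fixedPoints g)
fixedPoints-length≤ {n} f g ψ g-idem reflects =
  subst (_≤ length (fixedPoints g)) (List.length-map (g ∘ ψ) (fixedPoints f))
    (Unique-⊆⇒length≤ (Unique-map-on (g ∘ ψ) injective (Unique.filter⁺ _ (Unique.allFin⁺ n))) image⊆)
  where
  fixed : ∀ {a} → a ∈ fixedPoints f → f a ≡ a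
  fixed = proj₂ ∘ ∈-filter⁻ (λ w → f w ≟ w) {xs = allFin n}
  injective : ∀ {a b} → a ∈ fixedPoints f → b ∈ fixedPoints f → g (ψ a) ≡ g (ψ b) → a ≡ b
  injective a∈ b∈ eq = trans (sym (fixed a∈)) (trans (reflects _ _ eq) (fixed b∈))
  image⊆ : map (g ∘ ψ) (fixedPoints f) ⊆ fixedPoints g
  image⊆ z∈ with ∈-map⁻ (g ∘ ψ) z∈
  ... | w , _ , refl = ∈-filter⁺ (λ w → g w ≟ w) (∈-allFin _) (g-idem (ψ w))

components-≤ : ∀ {n m} {es : Edges n} {es′ : Edges m} (ψ : Fin n → Fin m) →
  (∀ {a b} → Connected es′ (ψ a) (ψ b) → Connected es a b) →
  components n es ≤ components m es′
components-≤ {es = es} {es′} ψ reflects =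
  fixedPoints-length≤ (label es) (label es′) ψ (label-idempotent es′)
    (λ _ _ → label-complete ∘ reflects ∘ label-sound)

module _ {n : ℕ} where

  private
    variable
      m : ℕ
      es es′ : Edges n
      a b u v : Fin n

  components-antitone : es ⊆ es′ → components n es′ ≤ components n es
  components-antitone es⊆es′ = components-≤ id (Connected-⊆ es⊆es′)

  components-cong : (∀ {a b} → Connected es a b → Connected es′ a b) →
    (∀ {a b} → Connected es′ a b → Connected es a b) →
    components n es ≡ components n es′
  components-cong to from = ℕ.≤-antisym (components-≤ id from) (components-≤ id to)

  components-⊆⊇ : es ⊆ es′ → es′ ⊆ es → components n es ≡ components n es′
  components-⊆⊇ es⊆es′ es′⊆es = components-cong (Connected-⊆ es⊆es′) (Connected-⊆ es′⊆es)

  components-transport : ∀ {es′ : Edges m} (φ : Fin n → Fin m) (σ : Fin m → Fin n) →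
    (∀ p → φ (σ p) ≡ p) → (∀ {a b} → Connected es a b ⇔ Connected es′ (φ a) (φ b)) →
    components m es′ ≡ components n es
  components-transport {es = es} {es′ = es′} φ σ φ∘σ≗id transports = ℕ.≤-antisym
    (components-≤ σ (λ {p} {q} → subst₂ (Connected es′) (φ∘σ≗id p) (φ∘σ≗id q) ∘ Equivalence.to transports))
    (components-≤ φ (Equivalence.from transports))

  components-↭ : es ↭ es′ → components n es ≡ components n es′
  components-↭ es↭es′ = components-⊆⊇ (⊆-reflexive-↭ es↭es′) (⊆-reflexive-↭ (↭-sym es↭es′))

  components-[] : components n [] ≡ n
  components-[] = trans (cong length (List.filter-all (λ w → w ≟ w) {allFin n} (All.tabulate (λ _ → refl))))
                        (List.length-tabulate id)

  components≤n : ∀ (es : Edges n) → components n es ≤ n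
  components≤n es = subst (components n es ≤_) (List.length-tabulate id) (List.length-filter _ (allFin n))

  label-∷ʳ : ∀ (es : Edges n) e w → label (es ∷ʳ e) w ≡ merge (label es) e w
  label-∷ʳ es e w = cong (λ f → f w) (List.foldl-++ merge id es [ e ])

  components-∷ʳ-disconnected : ¬ Connected es u v → components n es ≡ suc (components n (es ∷ʳ (u , v)))
  components-∷ʳ-disconnected {es} {u} {v} ¬u~v =
    length-filter-remove (λ w → label es w ≟ w) (λ w → label (es ∷ʳ (u , v)) w ≟ w)
      (Unique.allFin⁺ n) (∈-allFin (label es v)) (label-idempotent es v) fixed⇔
    where
    f = label es
    -- Merging removes exactly the fixed point f v, the representative of the class of v.
    fixed⇔ : ∀ w → (label (es ∷ʳ (u , v)) w ≡ w) ⇔ (f w ≡ w × w ≢ f v)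
    fixed⇔ w rewrite label-∷ʳ es (u , v) w with f w ≟ f v
    ... | yes fw≡fv = mk⇔
      (λ fu≡w → ⊥-elim (¬u~v (label-sound (trans (trans (sym (label-idempotent es u)) (cong f fu≡w)) fw≡fv))))
      (λ (fw≡w , w≢fv) → ⊥-elim (w≢fv (trans (sym fw≡w) fw≡fv)))
    ... | no fw≢fv = mk⇔ (λ fw≡w → fw≡w , λ w≡fv → fw≢fv (trans fw≡w w≡fv)) proj₁

  components-redundant : ∀ (ls es : Edges n) → (∀ {p q} → (p , q) ∈ ls → Connected es p q) →
    components n (ls ++ es) ≡ components n es
  components-redundant ls es redundant = components-cong (via-es ⋆) (Connected-⊆ (xs⊆ys++xs es ls))
    where
    via-es : ∀ {p q} → (p , q) ∈ ls ++ es → Connected es p q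
    via-es pq∈ with ∈-++⁻ ls pq∈
    ... | inj₁ pq∈ls = redundant pq∈ls
    ... | inj₂ pq∈es = edge pq∈es

  components-∷ : ∀ (es : Edges n) u v →
    components n ((u , v) ∷ es) ≡ components n es ⊎
    components n es ≡ suc (components n ((u , v) ∷ es))
  components-∷ es u v with connected? es u v
  ... | yes u~v = inj₁ (components-redundant [ (u , v) ] es (λ { (here refl) → u~v }))
  ... | no ¬u~v = inj₂ (trans (components-∷ʳ-disconnected ¬u~v)
                               (cong suc (components-↭ (↭-sym (∷↭∷ʳ (u , v) es)))))

  components≤suc-components-∷ : ∀ (es : Edges n) e → components n es ≤ suc (components n (e ∷ es))
  components≤suc-components-∷ es (u , v) with components-∷ es u v
  ... | inj₁ k′≡k = ℕ.≤-trans (ℕ.≤-reflexive (sym k′≡k)) (ℕ.n≤1+n _)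
  ... | inj₂ k≡1+k′ = ℕ.≤-reflexive k≡1+k′

  n≤components+length : ∀ (es : Edges n) → n ≤ components n es ℕ.+ length es
  n≤components+length [] = ℕ.≤-reflexive (sym (trans (ℕ.+-identityʳ _) components-[]))
  n≤components+length (e ∷ es) = begin
    n                                          ≤⟨ n≤components+length es ⟩
    components n es ℕ.+ length es              ≤⟨ ℕ.+-monoˡ-≤ (length es) (components≤suc-components-∷ es e) ⟩
    suc (components n (e ∷ es)) ℕ.+ length es  ≡⟨ ℕ.+-suc _ (length es) ⟨
    components n (e ∷ es) ℕ.+ length (e ∷ es)  ∎
    where open ℕ.≤-Reasoning

  rank≤length : ∀ (es : Edges n) → rank n es ≤ length es
  rank≤length es = ℕ.m≤n+o⇒m∸n≤o n (components n es) (n≤components+length es)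

  rank-mono : es ⊆ es′ → rank n es ≤ rank n es′
  rank-mono es⊆es′ = ℕ.∸-monoʳ-≤ n (components-antitone es⊆es′)

  rank-insert-loops : ∀ (a s c : Edges n) → (∀ {p q} → (p , q) ∈ s → p ≡ q) →
    rank n (a ++ s ++ c) ≡ rank n (a ++ c)
  rank-insert-loops a s c loops = cong (n ∸_) (trans (components-↭ (shifts a s))
    (components-redundant s (a ++ c) (λ pq∈s → subst (Connected (a ++ c) _) (loops pq∈s) ε)))

  rank-suc : ∀ {es es′ : Edges n} → components n es′ ≡ suc (components n es) → rank n es ≡ suc (rank n es′)
  rank-suc {es} {es′} k′≡1+k rewrite k′≡1+k =
    ℕ.+-∸-assoc 1 (subst (_≤ n) k′≡1+k (components≤n es′))

-- Contraction

graph-injective : ∀ {n} {xs ys : Edges n} → graph n xs ≡ graph n ys → xs ≡ ys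
graph-injective refl = refl

module Contraction {m : ℕ} {u v : Fin (suc m)} (u≢v : u ≢ v) where

  identify : Fin (suc m) → Fin m
  identify w with w ≟ v
  ... | yes _ = punchOut (u≢v ∘ sym)
  ... | no w≢v = punchOut (w≢v ∘ sym)

  identify² : Fin (suc m) × Fin (suc m) → Fin m × Fin m
  identify² (a , b) = identify a , identify b

  -- The two sides differ only in the inequality proofs handed to punchOut.
  contractAt≡ : ∀ es → contractAt u v es ≡ graph m (map identify² es)
  contractAt≡ [] with u ≟ v
  ... | yes u≡v = ⊥-elim (u≢v u≡v)
  ... | no _ = refl
  contractAt≡ ((a , b) ∷ es) with u ≟ v | contractAt≡ es
  ... | yes u≡v | _ = ⊥-elim (u≢v u≡v)
  ... | no _ | ih with a ≟ v | b ≟ v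
  ...   | yes _ | yes _ =
    cong (graph m) (cong₂ _∷_ (cong₂ _,_ (punchOut-cong v refl) (punchOut-cong v refl)) (graph-injective ih))
  ...   | yes _ | no _  = cong (graph m) (cong₂ _∷_ (cong₂ _,_ (punchOut-cong v refl) refl) (graph-injective ih))
  ...   | no _  | yes _ = cong (graph m) (cong₂ _∷_ (cong₂ _,_ refl (punchOut-cong v refl)) (graph-injective ih))
  ...   | no _  | no _  = cong (graph m) (cong (_ ∷_) (graph-injective ih))

  identify-ends : identify u ≡ identify v
  identify-ends with u ≟ v | v ≟ v
  ... | yes u≡v | _ = ⊥-elim (u≢v u≡v)
  ... | no _ | yes _ = punchOut-cong v refl
  ... | no _ | no v≢v = ⊥-elim (v≢v refl)

  identify-punchIn : ∀ p → identify (punchIn v p) ≡ p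
  identify-punchIn p with punchIn v p ≟ v
  ... | yes punchIn≡v = ⊥-elim (punchInᵢ≢i v p punchIn≡v)
  ... | no _ = trans (punchOut-cong v refl) (punchOut-punchIn v)

  module _ (A : Edges (suc m)) where

    punchIn-identify : ∀ w → Connected ((u , v) ∷ A) (punchIn v (identify w)) w
    punchIn-identify w with w ≟ v
    ... | yes refl = subst (λ z → Connected _ z w) (sym (punchIn-punchOut _)) (edge (here refl))
    ... | no w≢v = subst (λ z → Connected _ z w) (sym (punchIn-punchOut _)) ε

    Connected-contract : ∀ {a b} →
      Connected ((u , v) ∷ A) a b ⇔ Connected (map identify² A) (identify a) (identify b)
    Connected-contract = mk⇔ (gfold (EqClosure.isEquivalence _) identify down) up
      where
      down : ∀ {a b} → (a , b) ∈ (u , v) ∷ A → Connected (map identify² A) (identify a) (identify b)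
      down (here refl) = subst (Connected _ (identify u)) identify-ends ε
      down (there ab∈A) = edge (∈-map⁺ identify² ab∈A)
      lift-edge : ∀ {p q} → (p , q) ∈ map identify² A → Connected ((u , v) ∷ A) (punchIn v p) (punchIn v q)
      lift-edge pq∈ with ∈-map⁻ identify² pq∈
      ... | (a , b) , ab∈A , refl =
        punchIn-identify a ◅◅ edge (there ab∈A) ◅◅ connected-sym (punchIn-identify b)
      up : ∀ {a b} → Connected (map identify² A) (identify a) (identify b) → Connected ((u , v) ∷ A) a b
      up {a} {b} φa~φb = connected-sym (punchIn-identify a)
        ◅◅ gfold (EqClosure.isEquivalence _) (punchIn v) lift-edge φa~φb ◅◅ punchIn-identify b

    components-contract : components m (map identify² A) ≡ components (suc m) ((u , v) ∷ A)
    components-contract = components-transport identify (punchIn v) identify-punchIn Connected-contract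

    rank-contract : rank (suc m) ((u , v) ∷ A) ≡ suc (rank m (map identify² A))
    rank-contract rewrite sym components-contract = ℕ.+-∸-assoc 1 (components≤n (map identify² A))

  rank-insert-copies : ∀ (a s c : Edges (suc m)) → (∀ {z} → z ∈ s → z ≡ (u , v)) →
    rank (suc m) (a ++ (u , v) ∷ s ++ c) ≡ suc (rank m (map identify² (a ++ c)))
  rank-insert-copies a s c copies = trans (cong (suc m ∸_) same-components) (rank-contract (a ++ c))
    where
    parallel : ∀ {p q} → (p , q) ∈ s → Connected ((u , v) ∷ a ++ c) p q
    parallel pq∈s with copies pq∈s
    ... | refl = edge (here refl)
    same-components : components (suc m) (a ++ (u , v) ∷ s ++ c) ≡ components (suc m) ((u , v) ∷ a ++ c)
    same-components = trans (components-↭ (↭-trans (shifts a ((u , v) ∷ s)) (↭-sym (shift (u , v) s (a ++ c)))))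
                            (components-redundant s ((u , v) ∷ a ++ c) parallel)

copies : ℕ → List A → List A
copies t = concatMap (replicate t)

copies-⊆ : ∀ t (xs : List A) → copies t xs ⊆ xs
copies-⊆ t (x ∷ xs) z∈ with ∈-++⁻ (replicate t x) z∈
... | inj₁ z∈copies = here (∈-replicate⁻ t z∈copies)
... | inj₂ z∈rest = there (copies-⊆ t xs z∈rest)

⊆-copies : ∀ {t} → 1 ≤ t → (xs : List A) → xs ⊆ copies t xs
⊆-copies {t = suc t} _ (x ∷ xs) (here refl) = here refl
⊆-copies {t = suc t} t≥1 (x ∷ xs) (there z∈xs) = ∈-++⁺ʳ (replicate (suc t) x) (⊆-copies t≥1 xs z∈xs)

copies-map : ∀ t (f : A → B) xs → copies t (map f xs) ≡ map f (copies t xs)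
copies-map t f [] = refl
copies-map t f (x ∷ xs) = begin
  replicate t (f x) ++ copies t (map f xs)     ≡⟨ cong₂ _++_ (sym (List.map-replicate f t x)) (copies-map t f xs) ⟩
  map f (replicate t x) ++ map f (copies t xs) ≡⟨ List.map-++ f (replicate t x) (copies t xs) ⟨
  map f (replicate t x ++ copies t xs)         ∎
  where open ≡-Reasoning

components-copies : ∀ {n t} → 1 ≤ t → (es : Edges n) → components n (copies t es) ≡ components n es
components-copies t≥1 es = components-⊆⊇ (copies-⊆ _ es) (⊆-copies t≥1 es)

-- Sums over sub-multisets

module Sums {c ℓ : Level} (R : CommutativeRing c ℓ) where

  open CommutativeRing R renaming (refl to ≈-refl; sym to ≈-sym; trans to ≈-trans)
  open import Algebra.Properties.CommutativeSemigroup +-commutativeSemigroup using () renaming (interchange to +-interchange)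
  open import Relation.Binary.Reasoning.Setoid setoid

  ∑ : List A → (A → Carrier) → Carrier
  ∑ xs F = sumR R (map F xs)

  syntax ∑ xs (λ a → e) = ∑[ a ∈ xs ] e

  ∑-++ : ∀ (xs ys : List A) (F : A → Carrier) → ∑ (xs ++ ys) F ≈ ∑ xs F + ∑ ys F
  ∑-++ [] ys F = ≈-sym (+-identityˡ _)
  ∑-++ (x ∷ xs) ys F = ≈-trans (+-congˡ (∑-++ xs ys F)) (≈-sym (+-assoc _ _ _))

  ∑-map : ∀ (g : A → B) xs (F : B → Carrier) → ∑ (map g xs) F ≡ ∑ xs (F ∘ g)
  ∑-map g xs F = cong (sumR R) (sym (List.map-∘ xs))

  ∑-cong : ∀ (xs : List A) {F G : A → Carrier} → (∀ {a} → a ∈ xs → F a ≈ G a) → ∑ xs F ≈ ∑ xs G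
  ∑-cong [] _ = ≈-refl
  ∑-cong (x ∷ xs) F≈G = +-cong (F≈G (here refl)) (∑-cong xs (F≈G ∘ there))

  ∑-*ˡ : ∀ k (xs : List A) (F : A → Carrier) → ∑[ a ∈ xs ] (k * F a) ≈ k * ∑ xs F
  ∑-*ˡ k [] F = ≈-sym (zeroʳ k)
  ∑-*ˡ k (x ∷ xs) F = ≈-trans (+-congˡ (∑-*ˡ k xs F)) (≈-sym (distribˡ k _ _))

  ∑-+ : ∀ (xs : List A) (F G : A → Carrier) → ∑[ a ∈ xs ] (F a + G a) ≈ ∑ xs F + ∑ xs G
  ∑-+ [] F G = ≈-sym (+-identityˡ 0#)
  ∑-+ (x ∷ xs) F G = ≈-trans (+-congˡ (∑-+ xs F G)) (+-interchange _ _ _ _)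

  ∑-swap : ∀ (xs : List A) (ys : List B) (F : A → B → Carrier) →
    ∑[ a ∈ xs ] ∑[ b ∈ ys ] F a b ≈ ∑[ b ∈ ys ] ∑[ a ∈ xs ] F a b
  ∑-swap [] ys F = ≈-sym (∑-zero ys)
    where
    ∑-zero : ∀ (ys : List B) → ∑[ _ ∈ ys ] 0# ≈ 0#
    ∑-zero [] = ≈-refl
    ∑-zero (_ ∷ ys) = ≈-trans (+-identityˡ _) (∑-zero ys)
  ∑-swap (x ∷ xs) ys F = ≈-trans (+-congˡ (∑-swap xs ys F)) (≈-sym (∑-+ ys (F x) _))

  ∑-subsets-++ : ∀ (xs ys : List A) (F : List A → Carrier) →
    ∑ (subsets (xs ++ ys)) F ≈ ∑[ a ∈ subsets xs ] ∑[ c ∈ subsets ys ] F (a ++ c)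
  ∑-subsets-++ [] ys F = ≈-sym (+-identityʳ _)
  ∑-subsets-++ (x ∷ xs) ys F = begin
    ∑ (S ++ map (x ∷_) S) F                     ≈⟨ ∑-++ S (map (x ∷_) S) F ⟩
    ∑ S F + ∑ (map (x ∷_) S) F                  ≡⟨ cong (∑ S F +_) (∑-map (x ∷_) S F) ⟩
    ∑ S F + ∑ S (F ∘ (x ∷_))                    ≈⟨ +-cong (∑-subsets-++ xs ys F) (∑-subsets-++ xs ys (F ∘ (x ∷_))) ⟩
    ∑ (subsets xs) H + ∑ (subsets xs) (H ∘ (x ∷_)) ≡⟨ cong (∑ (subsets xs) H +_) (∑-map (x ∷_) (subsets xs) H) ⟨
    ∑ (subsets xs) H + ∑ (map (x ∷_) (subsets xs)) H ≈⟨ ∑-++ (subsets xs) (map (x ∷_) (subsets xs)) H ⟨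
    ∑ (subsets (x ∷ xs)) H                      ∎
    where
    S = subsets (xs ++ ys)
    H = λ a → ∑[ c ∈ subsets ys ] F (a ++ c)

  ∑-subsets-insert : ∀ (xs ms ys : List A) (F K : List A → Carrier) →
    (∀ {a c} → a ∈ subsets xs → c ∈ subsets ys → ∑[ s ∈ subsets ms ] F (a ++ s ++ c) ≈ K (a ++ c)) →
    ∑ (subsets (xs ++ ms ++ ys)) F ≈ ∑ (subsets (xs ++ ys)) K
  ∑-subsets-insert xs ms ys F K inner = begin
    ∑ (subsets (xs ++ ms ++ ys)) F
      ≈⟨ ∑-subsets-++ xs (ms ++ ys) F ⟩
    ∑[ a ∈ subsets xs ] ∑[ d ∈ subsets (ms ++ ys) ] F (a ++ d)
      ≈⟨ ∑-cong (subsets xs) (λ {a} _ → ∑-subsets-++ ms ys (λ d → F (a ++ d))) ⟩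
    ∑[ a ∈ subsets xs ] ∑[ s ∈ subsets ms ] ∑[ c ∈ subsets ys ] F (a ++ s ++ c)
      ≈⟨ ∑-cong (subsets xs) (λ {a} _ → ∑-swap (subsets ms) (subsets ys) (λ s c → F (a ++ s ++ c))) ⟩
    ∑[ a ∈ subsets xs ] ∑[ c ∈ subsets ys ] ∑[ s ∈ subsets ms ] F (a ++ s ++ c)
      ≈⟨ ∑-cong (subsets xs) (λ a∈ → ∑-cong (subsets ys) (λ c∈ → inner a∈ c∈)) ⟩
    ∑[ a ∈ subsets xs ] ∑[ c ∈ subsets ys ] K (a ++ c)
      ≈⟨ ∑-subsets-++ xs ys K ⟨
    ∑ (subsets (xs ++ ys)) K ∎

  pow-+ : ∀ a p q → pow R a (p ℕ.+ q) ≈ pow R a p * pow R a q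
  pow-+ a zero q = ≈-sym (*-identityˡ _)
  pow-+ a (suc p) q = ≈-trans (*-congˡ (pow-+ a p q)) (≈-sym (*-assoc _ _ _))

  module _ (y : Carrier) where

    private
      Y = y + - 1#

    1+Y≈y : 1# + Y ≈ y
    1+Y≈y = begin
      1# + (y + - 1#)  ≈⟨ +-comm _ _ ⟩
      (y + - 1#) + 1#  ≈⟨ +-assoc _ _ _ ⟩
      y + (- 1# + 1#)  ≈⟨ +-congˡ (-‿inverseˡ 1#) ⟩
      y + 0#           ≈⟨ +-identityʳ y ⟩
      y                ∎

    -- The binomial theorem  ∑ₖ (t choose k) (y - 1)ᵏ = yᵗ.
    ∑-subsets-replicate-pow : ∀ (e : A) t → ∑[ s ∈ subsets (replicate t e) ] pow R Y (length s) ≈ pow R y t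
    ∑-subsets-replicate-pow e zero = +-identityʳ _
    ∑-subsets-replicate-pow e (suc t) = begin
      ∑ (S ++ map (e ∷_) S) F           ≈⟨ ∑-++ S _ F ⟩
      ∑ S F + ∑ (map (e ∷_) S) F        ≡⟨ cong (∑ S F +_) (∑-map (e ∷_) S F) ⟩
      ∑ S F + ∑[ s ∈ S ] (Y * F s)      ≈⟨ +-cong ih (≈-trans (∑-*ˡ Y S F) (*-congˡ ih)) ⟩
      pow R y t + Y * pow R y t         ≈⟨ +-congʳ (*-identityˡ _) ⟨
      1# * pow R y t + Y * pow R y t    ≈⟨ distribʳ _ _ _ ⟨
      (1# + Y) * pow R y t              ≈⟨ *-congʳ 1+Y≈y ⟩
      y * pow R y t                     ∎
      where
      S = subsets (replicate t e)
      F = pow R Y ∘ length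
      ih = ∑-subsets-replicate-pow e t

    ∑-subsets-replicate : ∀ (e : A) t (G : List A → Carrier) β →
      (∀ s → e ∷ s ∈ subsets (replicate t e) → G (e ∷ s) ≈ β * pow R Y (length s)) →
      ∑ (subsets (replicate t e)) G ≈ G [] + geom R y t * β
    ∑-subsets-replicate e zero G β _ = +-congˡ (≈-sym (zeroˡ β))
    ∑-subsets-replicate e (suc t) G β G-e∷ = begin
      ∑ (S ++ map (e ∷_) S) G                           ≈⟨ ∑-++ S _ G ⟩
      ∑ S G + ∑ (map (e ∷_) S) G                        ≡⟨ cong (∑ S G +_) (∑-map (e ∷_) S G) ⟩
      ∑ S G + ∑ S (G ∘ (e ∷_))                          ≈⟨ +-cong ih (∑-cong S G-e∷-new) ⟩
      (G [] + geom R y t * β) + ∑[ s ∈ S ] (β * pow R Y (length s))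
        ≈⟨ +-congˡ (≈-trans (∑-*ˡ β S _) (*-congˡ (∑-subsets-replicate-pow e t))) ⟩
      (G [] + geom R y t * β) + β * pow R y t           ≈⟨ +-assoc _ _ _ ⟩
      G [] + (geom R y t * β + β * pow R y t)           ≈⟨ +-congˡ (+-congˡ (*-comm _ _)) ⟩
      G [] + (geom R y t * β + pow R y t * β)           ≈⟨ +-congˡ (distribʳ _ _ _) ⟨
      G [] + geom R y (suc t) * β                       ∎
      where
      S = subsets (replicate t e)
      ih = ∑-subsets-replicate e t G β (λ s → G-e∷ s ∘ ∈-++⁺ˡ)
      G-e∷-new : ∀ {s} → s ∈ S → G (e ∷ s) ≈ β * pow R Y (length s)
      G-e∷-new {s} s∈S = G-e∷ s (∈-++⁺ʳ S (∈-map⁺ (e ∷_) s∈S))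

module Tutte {c ℓ : Level} (R : CommutativeRing c ℓ) (x y : CommutativeRing.Carrier R) where

  open CommutativeRing R renaming (refl to ≈-refl; sym to ≈-sym; trans to ≈-trans)
  open Sums R
  open import Relation.Binary.Reasoning.Setoid setoid

  X Y : Carrier
  X = x + - 1#
  Y = y + - 1#

  -- tutte R (graph n E) x y unfolds to ∑ (subsets E) (term n E).
  term : ∀ n → Edges n → Edges n → Carrier
  term n E A = pow R X (rank n E ∸ rank n A) * pow R Y (length A ∸ rank n A)

  -- With d = 1 this covers contraction, which lowers the ranks of E and L by one.
  term-shift : ∀ {n n′} (E L : Edges n) (E′ A : Edges n′) d j →
    rank n E ≡ d ℕ.+ rank n′ E′ → rank n L ≡ d ℕ.+ rank n′ A → length L ≡ d ℕ.+ (length A ℕ.+ j) →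
    term n E L ≈ term n′ E′ A * pow R Y j
  term-shift {n} {n′} E L E′ A d j rank-E rank-L length-L = begin
    pow R X (rank n E ∸ rank n L) * pow R Y (length L ∸ rank n L)
      ≡⟨ cong₂ (λ p q → pow R X p * pow R Y q) corank nullity ⟩
    pow R X (rank n′ E′ ∸ rank n′ A) * pow R Y ((length A ∸ rank n′ A) ℕ.+ j)
      ≈⟨ *-congˡ (pow-+ Y (length A ∸ rank n′ A) j) ⟩
    pow R X (rank n′ E′ ∸ rank n′ A) * (pow R Y (length A ∸ rank n′ A) * pow R Y j)
      ≈⟨ *-assoc _ _ _ ⟨
    term n′ E′ A * pow R Y j ∎
    where
    corank : rank n E ∸ rank n L ≡ rank n′ E′ ∸ rank n′ A
    corank = trans (cong₂ _∸_ rank-E rank-L) (ℕ.[m+n]∸[m+o]≡n∸o d _ _)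
    nullity : length L ∸ rank n L ≡ (length A ∸ rank n′ A) ℕ.+ j
    nullity = trans (cong₂ _∸_ length-L rank-L)
      (trans (ℕ.[m+n]∸[m+o]≡n∸o d _ _) (ℕ.+-∸-comm j (rank≤length A)))

  tutte-[] : ∀ n → tutte R (graph n []) x y ≈ 1#
  tutte-[] n = ≈-trans (+-identityʳ _)
    (≈-trans (*-cong (exponent-0 (ℕ.n∸n≡0 (rank n []))) (exponent-0 (ℕ.0∸n≡0 (rank n [])))) (*-identityˡ 1#))
    where
    exponent-0 : ∀ {a k} → k ≡ 0 → pow R a k ≈ 1#
    exponent-0 refl = ≈-refl

  tutte-loop-copies : ∀ {n} t (P Q : Edges n) {u v} → u ≡ v →
    tutte R (graph n (P ++ replicate t (u , v) ++ Q)) x y ≈ pow R y t * tutte R (graph n (P ++ Q)) x y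
  tutte-loop-copies {n} t P Q {u} {v} u≡v = begin
    ∑ (subsets E) (term n E)
      ≈⟨ ∑-subsets-insert P Bₑ Q (term n E) (λ A → pow R y t * term n D A) inner ⟩
    ∑[ A ∈ subsets D ] (pow R y t * term n D A)
      ≈⟨ ∑-*ˡ (pow R y t) (subsets D) (term n D) ⟩
    pow R y t * ∑ (subsets D) (term n D) ∎
    where
    Bₑ = replicate t (u , v)
    E = P ++ Bₑ ++ Q
    D = P ++ Q
    loops : ∀ {s} → s ⊆ Bₑ → ∀ {p q} → (p , q) ∈ s → p ≡ q
    loops s⊆Bₑ pq∈s with ∈-replicate⁻ t (s⊆Bₑ pq∈s)
    ... | refl = u≡v
    inner : ∀ {a c} → a ∈ subsets P → c ∈ subsets Q →
      ∑[ s ∈ subsets Bₑ ] term n E (a ++ s ++ c) ≈ pow R y t * term n D (a ++ c)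
    inner {a} {c} _ _ = begin
      ∑[ s ∈ subsets Bₑ ] term n E (a ++ s ++ c)
        ≈⟨ ∑-cong (subsets Bₑ) (λ {s} s∈ → term-shift E (a ++ s ++ c) D (a ++ c) 0 (length s)
             (rank-insert-loops P Bₑ Q (loops id)) (rank-insert-loops a s c (loops (subsets-⊆ Bₑ s∈)))
             (length-shifts a s c)) ⟩
      ∑[ s ∈ subsets Bₑ ] (term n D (a ++ c) * pow R Y (length s))
        ≈⟨ ∑-*ˡ _ (subsets Bₑ) (pow R Y ∘ length) ⟩
      term n D (a ++ c) * ∑[ s ∈ subsets Bₑ ] pow R Y (length s)
        ≈⟨ *-congˡ (∑-subsets-replicate-pow y (u , v) t) ⟩
      term n D (a ++ c) * pow R y t
        ≈⟨ *-comm _ _ ⟩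
      pow R y t * term n D (a ++ c) ∎

  ∑-term-bridge : ∀ {n} (E D : Edges n) → rank n E ≡ suc (rank n D) →
    ∑[ A ∈ subsets D ] term n E A ≈ X * tutte R (graph n D) x y
  ∑-term-bridge {n} E D rank-E = ≈-trans (∑-cong (subsets D) one-more) (∑-*ˡ X (subsets D) (term n D))
    where
    one-more : ∀ {A} → A ∈ subsets D → term n E A ≈ X * term n D A
    one-more {A} A∈ rewrite rank-E | ℕ.+-∸-assoc 1 (rank-mono {es = A} (subsets-⊆ D A∈)) = *-assoc _ _ _

  ∑-term-non-bridge : ∀ {n} (E D : Edges n) → rank n E ≡ rank n D →
    ∑[ A ∈ subsets D ] term n E A ≡ tutte R (graph n D) x y
  ∑-term-non-bridge {n} E D rank-E =
    cong (λ r → ∑[ A ∈ subsets D ] (pow R X (r ∸ rank n A) * pow R Y (length A ∸ rank n A))) rank-E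

  module _ {m} {u v : Fin (suc m)} (u≢v : u ≢ v) where

    open Contraction u≢v

    tutte-non-loop-copies : ∀ t (P Q : Edges (suc m)) →
      tutte R (graph (suc m) (P ++ replicate t (u , v) ++ Q)) x y
        ≈ geom R y t * tutte R (graph m (map identify² (P ++ Q))) x y
          + ∑[ A ∈ subsets (P ++ Q) ] term (suc m) (P ++ replicate t (u , v) ++ Q) A
    tutte-non-loop-copies t P Q = begin
      ∑ (subsets E) (term (suc m) E)
        ≈⟨ ∑-subsets-insert P Bₑ Q (term (suc m) E) (λ A → term (suc m) E A + geom R y t * term/e A) inner ⟩
      ∑[ A ∈ subsets D ] (term (suc m) E A + geom R y t * term/e A)
        ≈⟨ ∑-+ (subsets D) (term (suc m) E) _ ⟩
      ∑ (subsets D) (term (suc m) E) + ∑[ A ∈ subsets D ] (geom R y t * term/e A)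
        ≈⟨ +-comm _ _ ⟩
      ∑[ A ∈ subsets D ] (geom R y t * term/e A) + ∑ (subsets D) (term (suc m) E)
        ≈⟨ +-congʳ (∑-*ˡ (geom R y t) (subsets D) term/e) ⟩
      geom R y t * ∑ (subsets D) term/e + ∑ (subsets D) (term (suc m) E)
        ≡⟨ cong (λ z → geom R y t * z + ∑ (subsets D) (term (suc m) E)) contracted-sum ⟨
      geom R y t * ∑ (subsets (map identify² D)) (term m (map identify² D)) + ∑ (subsets D) (term (suc m) E) ∎
      where
      e = (u , v)
      Bₑ = replicate t e
      E = P ++ Bₑ ++ Q
      D = P ++ Q
      term/e : Edges (suc m) → Carrier
      term/e A = term m (map identify² D) (map identify² A)
      contracted-sum : ∑ (subsets (map identify² D)) (term m (map identify² D)) ≡ ∑ (subsets D) term/e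
      contracted-sum = trans (cong (λ S → ∑ S (term m (map identify² D))) (subsets-map identify² D))
                             (∑-map (map identify²) (subsets D) _)
      rank-E : ∀ t′ {s} → e ∷ s ∈ subsets (replicate t′ e) →
        rank (suc m) (P ++ replicate t′ e ++ Q) ≡ suc (rank m (map identify² D))
      rank-E zero (here ())
      rank-E zero (there ())
      rank-E (suc t′) _ = rank-insert-copies P (replicate t′ e) Q (∈-replicate⁻ t′)
      inner : ∀ {a c} → a ∈ subsets P → c ∈ subsets Q →
        ∑[ s ∈ subsets Bₑ ] term (suc m) E (a ++ s ++ c) ≈ term (suc m) E (a ++ c) + geom R y t * term/e (a ++ c)
      inner {a} {c} _ _ = ∑-subsets-replicate y e t (λ s → term (suc m) E (a ++ s ++ c)) (term/e (a ++ c))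
        (λ s e∷s∈ → term-shift E (a ++ e ∷ s ++ c) (map identify² D) (map identify² (a ++ c)) 1 (length s)
          (rank-E t e∷s∈) (rank-insert-copies a s c (∈-replicate⁻ t ∘ subsets-⊆ Bₑ e∷s∈ ∘ there))
          length-L)
        where
        length-L : ∀ {s} → length (a ++ e ∷ s ++ c) ≡ suc (length (map identify² (a ++ c)) ℕ.+ length s)
        length-L {s} = trans (length-shifts a (e ∷ s) c)
          (trans (ℕ.+-suc _ (length s))
                 (cong (λ k → suc (k ℕ.+ length s)) (sym (List.length-map identify² (a ++ c)))))

-- Deletion and contraction for J

module Recurrences {c ℓ : Level} (R : CommutativeRing c ℓ) (t : ℕ) (x y : CommutativeRing.Carrier R) where

  open CommutativeRing R renaming (refl to ≈-refl; sym to ≈-sym; trans to ≈-trans)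
  open Sums R using (∑)
  open Tutte R x y
  open import Relation.Binary.Reasoning.Setoid setoid

  module AtEdge {n} (es : Edges n) (i : Fin (length es)) where

    open Split (removeAt-split es i) public

    u v : Fin n
    u = proj₁ (lookup es i)
    v = proj₂ (lookup es i)

    Ê D̂ : Edges n
    Ê = copies t before ++ replicate t (u , v) ++ copies t after
    D̂ = copies t before ++ copies t after

    copies-es≡Ê : copies t es ≡ Ê
    copies-es≡Ê = trans (cong (copies t) xs≡) (List.concatMap-++ (replicate t) before (lookup es i ∷ after))

    copies-removeAt≡D̂ : copies t (removeAt es i) ≡ D̂
    copies-removeAt≡D̂ = trans (cong (copies t) removeAt≡) (List.concatMap-++ (replicate t) before after)

    J≡tutte-Ê : J R t (graph n es) x y ≡ tutte R (graph n Ê) x y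
    J≡tutte-Ê = cong (λ L → tutte R (graph n L) x y) copies-es≡Ê

    J-delete≡tutte-D̂ : J R t (delete (graph n es) i) x y ≡ tutte R (graph n D̂) x y
    J-delete≡tutte-D̂ = cong (λ L → tutte R (graph n L) x y) copies-removeAt≡D̂

    components-es : components n es ≡ components n ((u , v) ∷ before ++ after)
    components-es = trans (cong (components n) xs≡) (components-↭ (shift (u , v) before after))

    components-removeAt : components n (removeAt es i) ≡ components n (before ++ after)
    components-removeAt = cong (components n) removeAt≡

    components-delete : components n (removeAt es i) ≡ components n es ⊎
                        components n (removeAt es i) ≡ suc (components n es)
    components-delete with components-∷ (before ++ after) u v
    ... | inj₁ k≡k′ = inj₁ (trans components-removeAt (sym (trans components-es k≡k′)))
    ... | inj₂ k′≡1+k = inj₂ (trans components-removeAt (trans k′≡1+k (cong suc (sym components-es))))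

    components-delete-loop : IsLoop (graph n es) i → components n (removeAt es i) ≡ components n es
    components-delete-loop u≡v = trans components-removeAt (sym (trans components-es
      (components-redundant [ (u , v) ] (before ++ after) (λ { (here refl) → subst (Connected _ u) u≡v ε }))))

    components-Ê : 1 ≤ t → components n Ê ≡ components n es
    components-Ê t≥1 = trans (cong (components n) (sym copies-es≡Ê)) (components-copies t≥1 es)

    components-D̂ : 1 ≤ t → components n D̂ ≡ components n (removeAt es i)
    components-D̂ t≥1 = trans (cong (components n) (sym copies-removeAt≡D̂)) (components-copies t≥1 (removeAt es i))

    components-delete-bridge : IsBridge (graph n es) i → components n (removeAt es i) ≡ suc (components n es)
    components-delete-bridge bridge with components-delete
    ... | inj₁ k′≡k = ⊥-elim (ℕ.<-irrefl (sym k′≡k) bridge)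
    ... | inj₂ k′≡1+k = k′≡1+k

    components-delete-non-bridge : ¬ IsBridge (graph n es) i → components n (removeAt es i) ≡ components n es
    components-delete-non-bridge ¬bridge with components-delete
    ... | inj₁ k′≡k = k′≡k
    ... | inj₂ k′≡1+k = ⊥-elim (¬bridge (subst (components n es <_) (sym k′≡1+k) (ℕ.n<1+n _)))

  J-empty : ∀ (G : Graph) → edges G ≡ [] → J R t G x y ≈ 1#
  J-empty (graph n []) refl = tutte-[] n

  J-loop : ∀ (G : Graph) (e : Edge G) → IsLoop G e → J R t G x y ≈ pow R y t * J R t (delete G e) x y
  J-loop (graph n es) i u≡v = begin
    J R t (graph n es) x y                         ≡⟨ J≡tutte-Ê ⟩
    tutte R (graph n Ê) x y                        ≈⟨ tutte-loop-copies t (copies t before) (copies t after) u≡v ⟩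
    pow R y t * tutte R (graph n D̂) x y            ≡⟨ cong (pow R y t *_) J-delete≡tutte-D̂ ⟨
    pow R y t * J R t (delete (graph n es) i) x y  ∎
    where open AtEdge es i

  J-non-loop : ∀ {m} (es : Edges (suc m)) i → ¬ IsLoop (graph (suc m) es) i →
    J R t (graph (suc m) es) x y
      ≈ geom R y t * J R t (contract (graph (suc m) es) i) x y
        + ∑ (subsets (AtEdge.D̂ es i)) (term (suc m) (AtEdge.Ê es i))
  J-non-loop {m} es i u≢v = begin
    J R t (graph (suc m) es) x y
      ≡⟨ J≡tutte-Ê ⟩
    tutte R (graph (suc m) Ê) x y
      ≈⟨ tutte-non-loop-copies u≢v t (copies t before) (copies t after) ⟩
    geom R y t * tutte R (graph m (map identify² D̂)) x y + ∑ (subsets D̂) (term (suc m) Ê)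
      ≡⟨ cong (λ z → geom R y t * z + ∑ (subsets D̂) (term (suc m) Ê)) J-contract ⟨
    geom R y t * J R t (contract (graph (suc m) es) i) x y + ∑ (subsets D̂) (term (suc m) Ê) ∎
    where
    open AtEdge es i
    open Contraction u≢v
    J-contract : J R t (contract (graph (suc m) es) i) x y ≡ tutte R (graph m (map identify² D̂)) x y
    J-contract = trans (cong (λ G → tutte R (hat t G) x y) (contractAt≡ (removeAt es i)))
      (cong (λ L → tutte R (graph m L) x y)
            (trans (copies-map t identify² (removeAt es i)) (cong (map identify²) copies-removeAt≡D̂)))

  J-bridge : 1 ≤ t → ∀ (G : Graph) (e : Edge G) → IsBridge G e →
    J R t G x y ≈ geom R y t * J R t (contract G e) x y + X * J R t (delete G e) x y
  J-bridge t≥1 (graph zero es) i _ with proj₁ (lookup es i)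
  ... | ()
  J-bridge t≥1 (graph (suc m) es) i bridge = begin
    J R t (graph (suc m) es) x y
      ≈⟨ J-non-loop es i not-loop ⟩
    geom R y t * J R t (contract (graph (suc m) es) i) x y + ∑ (subsets D̂) (term (suc m) Ê)
      ≈⟨ +-congˡ (∑-term-bridge Ê D̂ (rank-suc {es = Ê} {es′ = D̂} one-more-component)) ⟩
    geom R y t * J R t (contract (graph (suc m) es) i) x y + X * tutte R (graph (suc m) D̂) x y
      ≡⟨ cong (λ z → geom R y t * J R t (contract (graph (suc m) es) i) x y + X * z) J-delete≡tutte-D̂ ⟨
    geom R y t * J R t (contract (graph (suc m) es) i) x y + X * J R t (delete (graph (suc m) es) i) x y ∎
    where
    open AtEdge es i
    not-loop : ¬ IsLoop (graph (suc m) es) i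
    not-loop loop = ℕ.<-irrefl (sym (components-delete-loop loop)) bridge
    one-more-component : components (suc m) D̂ ≡ suc (components (suc m) Ê)
    one-more-component = trans (components-D̂ t≥1)
      (trans (components-delete-bridge bridge) (cong suc (sym (components-Ê t≥1))))

  J-ordinary : 1 ≤ t → ∀ (G : Graph) (e : Edge G) → ¬ IsLoop G e → ¬ IsBridge G e →
    J R t G x y ≈ geom R y t * J R t (contract G e) x y + J R t (delete G e) x y
  J-ordinary t≥1 (graph zero es) i _ _ with proj₁ (lookup es i)
  ... | ()
  J-ordinary t≥1 (graph (suc m) es) i not-loop not-bridge = begin
    J R t (graph (suc m) es) x y
      ≈⟨ J-non-loop es i not-loop ⟩
    geom R y t * J R t (contract (graph (suc m) es) i) x y + ∑ (subsets D̂) (term (suc m) Ê)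
      ≡⟨ cong (geom R y t * J R t (contract (graph (suc m) es) i) x y +_)
              (trans (∑-term-non-bridge Ê D̂ rank-Ê) (sym J-delete≡tutte-D̂)) ⟩
    geom R y t * J R t (contract (graph (suc m) es) i) x y + J R t (delete (graph (suc m) es) i) x y ∎
    where
    open AtEdge es i
    rank-Ê : rank (suc m) Ê ≡ rank (suc m) D̂
    rank-Ê = cong (suc m ∸_) (trans (components-Ê t≥1)
                              (sym (trans (components-D̂ t≥1) (components-delete-non-bridge not-bridge))))

mainTheorem3 : ∀ {c ℓ : Level} (R : CommutativeRing c ℓ) (t : ℕ) → 1 ≤ t →
    let open CommutativeRing R in
    (x y : Carrier) →
      (∀ (G : Graph) → edges G ≡ [] → J R t G x y ≈ 1#)
    × (∀ (G : Graph) (e : Edge G) → IsLoop G e →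
         J R t G x y ≈ pow R y t * J R t (delete G e) x y)
    × (∀ (G : Graph) (e : Edge G) → IsBridge G e →
         J R t G x y ≈ geom R y t * J R t (contract G e) x y + (x + - 1#) * J R t (delete G e) x y)
    × (∀ (G : Graph) (e : Edge G) → ¬ IsLoop G e → ¬ IsBridge G e →
         J R t G x y ≈ geom R y t * J R t (contract G e) x y + J R t (delete G e) x y)
mainTheorem3 R t t≥1 x y = J-empty , J-loop , J-bridge t≥1 , J-ordinary t≥1
  where open Recurrences R t x y
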